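{- Let $\alpha\in\mathbb{C}$ with $|\alpha|=1$, let $D$ be an $\alpha$-monograph of first kind, and let $U$ be a connected subgraph of $D$ all of whose edges are digons. Let $M$ be a finite set of new vertices and, for each $x\in M$, let $V_x\subseteq V(U)$. Form $\tilde D$ from $D$ by adding the vertices of $M$ and, for each $x\in M$, joining $x$ by arcs to exactly the vertices of $V_x$, either all directed out of $x$ (so $N^+_{\tilde D}(x)=V_x$) or all directed into $x$ (so $N^-_{\tilde D}(x)=V_x$), with no other edges at $x$. Then $\tilde D$ is an $\alpha$-monograph of first kind.
   Context: A mixed graph $D$ is obtained from a finite simple undirected graph $\Gamma(D)$ by replacing some edges by arcs: between any two adjacent vertices $u,v$ there is exactly one of a digon $u\sim v$, an arc $u\to v$, or an arc $v\to u$. $N^+(x)$ (resp. $N^-(x)$) is the set of vertices $v$ with an arc $x\to v$ (resp. $v\to x$). For $|\alpha|=1$ set $h_{uv}=1$ if $u\sim v$, $\alpha$ if $u\to v$, $\bar\alpha$ if $v\to u$. A mixed walk $W=v_1,\dots,v_k$ (consecutive vertices adjacent in $\Gamma(D)$) has value $h_\alpha(W)=h_{v_1v_2}\cdots h_{v_{k-1}v_k}$. For a cycle $C$ of $\Gamma(D)$ with vertices $v_1,\dots,v_\ell$ in cyclic order, a traversal $\vec C$ is the closed walk $v_1,\dots,v_\ell,v_1$ (either direction, any start). A mixed graph is an $\alpha$-monograph of first kind if $h_\alpha(\vec C)=1$ for every cycle $C$ and every traversal $\vec C$. -}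

module Defs where

open import Level using (Level)
open import Data.Nat using (ℕ; _≤_; _+_)
open import Data.Fin using (Fin; splitAt)
open import Data.Fin.Subset using (Subset; _∈_)
open import Data.Vec using (lookup)
open import Data.Bool using (Bool; true; false; if_then_else_)
open import Data.Sum using (inj₁; inj₂)
open import Data.Product using (_×_)
open import Data.List using (List; []; _∷_; _++_; [_]; length)
open import Data.List.Relation.Unary.Linked using (Linked)
open import Data.List.Relation.Unary.Unique.Propositional using (Unique)
open import Relation.Binary.PropositionalEquality using (_≡_; _≢_)
open import Relation.Binary.Construct.Closure.ReflexiveTransitive using (Star)
open import Algebra.Bundles using (AbelianGroup)

-- Relation of an ordered pair (u , v) in a mixed graph:
--   none : u, v not adjacent
--   dig  : digon u ~ v
--   out  : arc u → v
--   inn  : arc v → u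
data Adj : Set where
  none dig out inn : Adj

rev : Adj → Adj
rev none = none
rev dig  = dig
rev out  = inn
rev inn  = out

AdjMat : ℕ → Set
AdjMat n = Fin n → Fin n → Adj

record IsMixedGraph {n : ℕ} (A : AdjMat n) : Set where
  field
    loopless : ∀ u → A u u ≡ none
    converse : ∀ u v → A v u ≡ rev (A u v)

Adjacent : {n : ℕ} → AdjMat n → Fin n → Fin n → Set
Adjacent A u v = A u v ≢ none

module _ {c ℓ : Level} (G : AbelianGroup c ℓ) (α : AbelianGroup.Carrier G) where
  open AbelianGroup G

  -- h_{uv}: 1 for a digon, α for u → v, ᾱ = α⁻¹ for v → u
  hval : Adj → Carrier
  hval none = ε
  hval dig  = ε
  hval out  = α
  hval inn  = α ⁻¹

  walkVal : {n : ℕ} → AdjMat n → List (Fin n) → Carrier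
  walkVal A []               = ε
  walkVal A (u ∷ [])         = ε
  walkVal A (u ∷ v ∷ rest)   = hval (A u v) ∙ walkVal A (v ∷ rest)

  -- α-monograph of first kind: every traversal v, v₂, …, vℓ, v of every cycle
  -- (ℓ ≥ 3 distinct vertices, consecutive ones adjacent, vℓ adjacent to v)
  -- has value 1.
  IsMonograph : {n : ℕ} → AdjMat n → Set ℓ
  IsMonograph {n} A =
    ∀ (v : Fin n) (rest : List (Fin n)) →
    2 ≤ length rest →
    Unique (v ∷ rest) →
    Linked (Adjacent A) (v ∷ rest ++ [ v ]) →
    walkVal A (v ∷ rest ++ [ v ]) ≈ ε

record DigonConnectedSubgraph {n : ℕ} (A : AdjMat n) : Set₁ where
  field
    verts   : Subset n
    E       : Fin n → Fin n → Set
    E-sym   : ∀ {u v} → E u v → E v u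
    E-verts : ∀ {u v} → E u v → u ∈ verts × v ∈ verts
    E-digon : ∀ {u v} → E u v → A u v ≡ dig
    connected : ∀ {u v} → u ∈ verts → v ∈ verts → Star E u v

data Orientation : Set where
  outward : Orientation
  inward  : Orientation

arcFrom : Orientation → Adj
arcFrom outward = out
arcFrom inward  = inn

-- D̃: old vertices are Fin n (first block), the m new vertices are the last block.
extend : {n m : ℕ} → AdjMat n → (Fin m → Subset n) → (Fin m → Orientation) →
         AdjMat (n + m)
extend {n} A V o i j with splitAt n i | splitAt n j
... | inj₁ u | inj₁ v = A u v
... | inj₂ x | inj₁ v = if lookup (V x) v then arcFrom (o x) else none
... | inj₁ v | inj₂ x = if lookup (V x) v then rev (arcFrom (o x)) else none
... | inj₂ x | inj₂ y = none

-- In a monograph every closed walk has value 1: erasing loops one at a time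
-- (each erased loop is a cycle or a backtrack, hence of value 1) turns a closed
-- walk into a single vertex.  A closed walk of D̃ through a new vertex x enters
-- and leaves x through two vertices a, c of V_x along arcs of the same
-- orientation, whose values cancel; replacing the detour a → x → c by a digon
-- path of U from a to c, of value 1, yields a closed walk of D of the same value.
module Submission where

open import Data.Nat using (ℕ; _+_; s≤s; z≤n)
open import Data.Fin using (Fin; splitAt; _↑ˡ_; _↑ʳ_; _≟_)
open import Data.Fin.Properties using (splitAt-↑ˡ; splitAt-↑ʳ; splitAt⁻¹-↑ˡ; splitAt⁻¹-↑ʳ)
open import Data.Fin.Subset using (Subset; _⊆_; _∈_)
open import Data.Vec using (lookup)
open import Data.Vec.Properties using (lookup⇒[]=)
open import Data.Bool using (Bool; true; false; if_then_else_)
open import Data.Sum using (inj₁; inj₂)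
open import Data.Product using (Σ; _×_; _,_)
open import Data.Empty using (⊥-elim)
open import Data.List using (List; []; _∷_; _++_; [_])
open import Data.List.Properties using (++-assoc)
open import Data.List.Relation.Unary.Linked using (Linked; []; [-]; _∷_)
open import Data.List.Relation.Unary.All using ([]; _∷_)
open import Data.List.Relation.Unary.All.Properties using (¬Any⇒All¬; ++⁻)
open import Data.List.Relation.Unary.Any using (any?)
open import Data.List.Relation.Unary.AllPairs using ([]; _∷_)
open import Data.List.Relation.Unary.Unique.Propositional using (Unique)
open import Data.List.Membership.Propositional.Properties using (∈-∃++)
open import Relation.Nullary using (yes; no)
open import Relation.Binary.Core using (Rel)
open import Relation.Binary.PropositionalEquality as ≡ using (_≡_; _≢_; cong; subst)
open import Relation.Binary.Construct.Closure.ReflexiveTransitive as Star using (Star; _◅_; _◅◅_)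
open import Algebra.Bundles using (AbelianGroup)
open import Level using (0ℓ)
open import Defs

module _ {a r} {X : Set a} {R : Rel X r} where

  linked-++⁻ : ∀ xs {y ys} → Linked R (xs ++ y ∷ ys) → Linked R (xs ++ [ y ]) × Linked R (y ∷ ys)
  linked-++⁻ []            l       = [-] , l
  linked-++⁻ (x ∷ [])      (r ∷ l) = r ∷ [-] , l
  linked-++⁻ (x ∷ x′ ∷ xs) (r ∷ l) with linked-++⁻ (x′ ∷ xs) l
  ... | l₁ , l₂ = r ∷ l₁ , l₂

  linked-++⁺ : ∀ xs {y ys} → Linked R (xs ++ [ y ]) → Linked R (y ∷ ys) → Linked R (xs ++ y ∷ ys)
  linked-++⁺ []            _        l = l
  linked-++⁺ (x ∷ [])      (r ∷ _)  l = r ∷ l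
  linked-++⁺ (x ∷ x′ ∷ xs) (r ∷ l₁) l = r ∷ linked-++⁺ (x′ ∷ xs) l₁ l

  linked-rotate : ∀ {u v} ws → Linked R (u ∷ v ∷ ws ++ [ u ]) → Linked R (v ∷ (ws ++ [ u ]) ++ [ v ])
  linked-rotate {u} {v} ws (r ∷ l) =
    subst (λ zs → Linked R (v ∷ zs)) (≡.sym (++-assoc ws [ u ] [ v ]))
      (linked-++⁺ (v ∷ ws) l (r ∷ [-]))

  path : ∀ {u v} → Star R u v → List X
  path Star.ε             = []
  path (_◅_ {j = j} _ w) = j ∷ path w

  linked-path : ∀ {u v} (w : Star R u v) → Linked R (u ∷ path w)
  linked-path Star.ε = [-]
  linked-path (r ◅ w) = r ∷ linked-path w

  path-◅ : ∀ {u j v} (r : R u j) (w : Star R j v) → Σ (List X) λ xs → path (r ◅ w) ≡ xs ++ [ v ]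
  path-◅ r Star.ε = [] , ≡.refl
  path-◅ {j = j} r (r′ ◅ w) with path-◅ r′ w
  ... | xs , eq = j ∷ xs , cong (j ∷_) eq

unique-++⁻ : ∀ {a} {X : Set a} xs {y : X} {ys} →
             Unique (xs ++ y ∷ ys) → Unique (y ∷ xs) × Unique (y ∷ ys)
unique-++⁻ []       u        = [] ∷ [] , u
unique-++⁻ (x ∷ xs) (x∉ ∷ u) with unique-++⁻ xs u | ++⁻ xs x∉
... | y∉xs ∷ uxs , uys | x∉xs , x≢y ∷ _ = ((λ y≡x → x≢y (≡.sym y≡x)) ∷ y∉xs) ∷ x∉xs ∷ uxs , uys

module _ {c ℓ} (G : AbelianGroup c ℓ) (α : AbelianGroup.Carrier G) where
  open AbelianGroup G
  open import Relation.Binary.Reasoning.Setoid setoid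

  h : Adj → Carrier
  h = hval G α

  W : ∀ {k} → AdjMat k → List (Fin k) → Carrier
  W = walkVal G α

  h-rev : ∀ t → h t ∙ h (rev t) ≈ ε
  h-rev none = identityˡ ε
  h-rev dig  = identityˡ ε
  h-rev out  = inverseʳ α
  h-rev inn  = inverseˡ α

  walkVal-++ : ∀ {k} (A : AdjMat k) xs {y ys} → W A (xs ++ y ∷ ys) ≈ W A (xs ++ [ y ]) ∙ W A (y ∷ ys)
  walkVal-++ A []            = sym (identityˡ _)
  walkVal-++ A (x ∷ [])      = sym (trans (assoc _ _ _) (∙-congˡ (identityˡ _)))
  walkVal-++ A (x ∷ x′ ∷ xs) = trans (∙-congˡ (walkVal-++ A (x′ ∷ xs))) (sym (assoc _ _ _))

  walkVal-rotate : ∀ {k} (A : AdjMat k) {u v} ws →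
                   W A (u ∷ v ∷ ws ++ [ u ]) ≈ W A (v ∷ (ws ++ [ u ]) ++ [ v ])
  walkVal-rotate A {u} {v} ws = begin
    h (A u v) ∙ W A (v ∷ ws ++ [ u ])        ≈⟨ comm _ _ ⟩
    W A (v ∷ ws ++ [ u ]) ∙ h (A u v)        ≈⟨ ∙-congˡ (sym (identityʳ _)) ⟩
    W A (v ∷ ws ++ [ u ]) ∙ W A (u ∷ [ v ])  ≈⟨ sym (walkVal-++ A (v ∷ ws)) ⟩
    W A (v ∷ ws ++ u ∷ [ v ])                ≡⟨ cong (λ zs → W A (v ∷ zs)) (≡.sym (++-assoc ws [ u ] [ v ])) ⟩
    W A (v ∷ (ws ++ [ u ]) ++ [ v ])         ∎

  Walk : ∀ {k} → AdjMat k → Rel (Fin k) 0ℓ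
  Walk A = Star (Adjacent A)

  starVal : ∀ {k} {A : AdjMat k} {u v} → Walk A u v → Carrier
  starVal {A = A} {u} w = W A (u ∷ path w)

  starVal-◅◅ : ∀ {k} {A : AdjMat k} {u v w} (p : Walk A u v) (q : Walk A v w) →
               starVal (p ◅◅ q) ≈ starVal p ∙ starVal q
  starVal-◅◅ Star.ε   q = sym (identityˡ _)
  starVal-◅◅ (r ◅ p) q = trans (∙-congˡ (starVal-◅◅ p q)) (sym (assoc _ _ _))

  module Monograph {n} {A : AdjMat n} (mixed : IsMixedGraph A) (mono : IsMonograph G α A) where
    open IsMixedGraph mixed

    adjacent⇒≢ : ∀ {u v} → Adjacent A u v → u ≢ v
    adjacent⇒≢ adj ≡.refl = adj (loopless _)

    cycle-trivial : ∀ u ps → Unique (u ∷ ps) → Linked (Adjacent A) (u ∷ ps ++ [ u ]) →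
                    W A (u ∷ ps ++ [ u ]) ≈ ε
    cycle-trivial u []             _ (adj ∷ _) = ⊥-elim (adjacent⇒≢ adj ≡.refl)
    cycle-trivial u (v ∷ [])       _ _         = begin
      h (A u v) ∙ (h (A v u) ∙ ε)   ≈⟨ ∙-congˡ (identityʳ _) ⟩
      h (A u v) ∙ h (A v u)         ≡⟨ cong (λ t → h (A u v) ∙ h t) (converse u v) ⟩
      h (A u v) ∙ h (rev (A u v))   ≈⟨ h-rev (A u v) ⟩
      ε                             ∎
    cycle-trivial u ps@(_ ∷ _ ∷ _) uniq lnk = mono u ps (s≤s (s≤s z≤n)) uniq lnk

    cycle-excise : ∀ u cs ys → Unique (u ∷ cs) → Linked (Adjacent A) (u ∷ cs ++ u ∷ ys) →
                   Linked (Adjacent A) (u ∷ ys) × W A (u ∷ cs ++ u ∷ ys) ≈ W A (u ∷ ys)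
    cycle-excise u cs ys uniq lnk with linked-++⁻ (u ∷ cs) lnk
    ... | lnk-cycle , lnk-rest = lnk-rest , (begin
      W A (u ∷ cs ++ u ∷ ys)                   ≈⟨ walkVal-++ A (u ∷ cs) ⟩
      W A (u ∷ cs ++ [ u ]) ∙ W A (u ∷ ys)     ≈⟨ ∙-congʳ (cycle-trivial u cs uniq lnk-cycle) ⟩
      ε ∙ W A (u ∷ ys)                         ≈⟨ identityˡ _ ⟩
      W A (u ∷ ys)                             ∎)

    -- The suffix zs is carried along so that the erased walk keeps its end.
    loop-erase : ∀ zs u ws → Linked (Adjacent A) (u ∷ ws ++ zs) →
                Σ (List (Fin n)) λ ps → Unique (u ∷ ps) × Linked (Adjacent A) (u ∷ ps ++ zs) ×
                                        W A (u ∷ ws ++ zs) ≈ W A (u ∷ ps ++ zs)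
    loop-erase zs u []       lnk = [] , [] ∷ [] , lnk , refl
    loop-erase zs u (v ∷ ws) (adj ∷ lnk) with loop-erase zs v ws lnk
    ... | ps , uniq , lnk′ , eq with any? (u ≟_) ps
    ...   | no u∉ps = v ∷ ps , (adjacent⇒≢ adj ∷ ¬Any⇒All¬ ps u∉ps) ∷ uniq , adj ∷ lnk′ , ∙-congˡ eq
    ...   | yes u∈ps with ∈-∃++ u∈ps
    ...     | p₁ , p₂ , ≡.refl rewrite ++-assoc p₁ (u ∷ p₂) zs with unique-++⁻ (v ∷ p₁) uniq
    ...       | uniq-cycle , uniq-rest with cycle-excise u (v ∷ p₁) (p₂ ++ zs) uniq-cycle (adj ∷ lnk′)
    ...         | lnk″ , excised = p₂ , uniq-rest , lnk″ , trans (∙-congˡ eq) excised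

    closed-walk-trivial : ∀ {u} (w : Walk A u u) → starVal w ≈ ε
    closed-walk-trivial Star.ε = refl
    closed-walk-trivial {u} w@(adj ◅ w′) with path-◅ adj w′
    ... | xs , closes
      with loop-erase [ u ] u xs (subst (λ zs → Linked (Adjacent A) (u ∷ zs)) closes (linked-path w))
    ... | ps , uniq , lnk , erased = begin
      starVal w              ≡⟨ cong (λ zs → W A (u ∷ zs)) closes ⟩
      W A (u ∷ xs ++ [ u ])  ≈⟨ erased ⟩
      W A (u ∷ ps ++ [ u ])  ≈⟨ cycle-trivial u ps uniq lnk ⟩
      ε                      ∎

  module Extension {n} {A : AdjMat n} (mixed : IsMixedGraph A) (mono : IsMonograph G α A)
                   (U : DigonConnectedSubgraph A) {m} (V : Fin m → Subset n) (o : Fin m → Orientation)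
                   (V⊆U : ∀ x → V x ⊆ DigonConnectedSubgraph.verts U) where
    open DigonConnectedSubgraph U
    open Monograph mixed mono

    old : Fin n → Fin (n + m)
    old a = a ↑ˡ m

    new : Fin m → Fin (n + m)
    new x = n ↑ʳ x

    data Side : Fin (n + m) → Set where
      old-vertex : ∀ a → Side (old a)
      new-vertex : ∀ x → Side (new x)

    side : ∀ i → Side i
    side i with splitAt n i in eq
    ... | inj₁ a = subst Side (splitAt⁻¹-↑ˡ eq) (old-vertex a)
    ... | inj₂ x = subst Side (splitAt⁻¹-↑ʳ eq) (new-vertex x)

    B : AdjMat (n + m)
    B = extend A V o

    extend-old-old : ∀ a b → B (old a) (old b) ≡ A a b
    extend-old-old a b rewrite splitAt-↑ˡ n a m | splitAt-↑ˡ n b m = ≡.refl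

    extend-new-old : ∀ x c → B (new x) (old c) ≡ (if lookup (V x) c then arcFrom (o x) else none)
    extend-new-old x c rewrite splitAt-↑ʳ n m x | splitAt-↑ˡ n c m = ≡.refl

    extend-old-new : ∀ c x → B (old c) (new x) ≡ (if lookup (V x) c then rev (arcFrom (o x)) else none)
    extend-old-new c x rewrite splitAt-↑ˡ n c m | splitAt-↑ʳ n m x = ≡.refl

    extend-new-new : ∀ x y → B (new x) (new y) ≡ none
    extend-new-new x y rewrite splitAt-↑ʳ n m x | splitAt-↑ʳ n m y = ≡.refl

    if-≢none : ∀ (b : Bool) {t} → (if b then t else none) ≢ none → b ≡ true
    if-≢none true  _     = ≡.refl
    if-≢none false ≢none = ⊥-elim (≢none ≡.refl)

    old-edge : ∀ {a b} → Adjacent B (old a) (old b) → Adjacent A a b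
    old-edge {a} {b} = subst (_≢ none) (extend-old-old a b)

    out-of-new : ∀ {x c} → Adjacent B (new x) (old c) → lookup (V x) c ≡ true
    out-of-new {x} {c} adj = if-≢none _ λ eq → adj (≡.trans (extend-new-old x c) eq)

    into-new : ∀ {c x} → Adjacent B (old c) (new x) → lookup (V x) c ≡ true
    into-new {c} {x} adj = if-≢none _ λ eq → adj (≡.trans (extend-old-new c x) eq)

    ∈U : ∀ {x c} → lookup (V x) c ≡ true → c ∈ verts
    ∈U {x} {c} c∈Vx = V⊆U x (lookup⇒[]= c (V x) c∈Vx)

    digonWalk : ∀ {a c} → Star E a c → Walk A a c
    digonWalk = Star.map λ e eq → dig≢none (≡.trans (≡.sym (E-digon e)) eq)
      where
      dig≢none : dig ≢ none
      dig≢none ()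

    starVal-digonWalk : ∀ {a c} (s : Star E a c) → starVal (digonWalk s) ≈ ε
    starVal-digonWalk Star.ε  = refl
    starVal-digonWalk (e ◅ s) =
      trans (∙-cong (reflexive (cong h (E-digon e))) (starVal-digonWalk s)) (identityˡ ε)

    bridge : ∀ {a x c} → Adjacent B (old a) (new x) → Adjacent B (new x) (old c) → Walk A a c
    bridge adj₁ adj₂ = digonWalk (connected (∈U (into-new adj₁)) (∈U (out-of-new adj₂)))

    starVal-bridge : ∀ {a x c} (adj₁ : Adjacent B (old a) (new x)) (adj₂ : Adjacent B (new x) (old c)) →
                     starVal (bridge adj₁ adj₂) ≈ ε
    starVal-bridge adj₁ adj₂ = starVal-digonWalk (connected (∈U (into-new adj₁)) (∈U (out-of-new adj₂)))

    arcs-at-new-cancel : ∀ {a x c} → Adjacent B (old a) (new x) → Adjacent B (new x) (old c) →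
                         h (B (old a) (new x)) ∙ h (B (new x) (old c)) ≈ ε
    arcs-at-new-cancel {a} {x} {c} adj₁ adj₂ with into-new adj₁ | out-of-new adj₂
    ... | a∈Vx | c∈Vx rewrite extend-old-new a x | extend-new-old x c | a∈Vx | c∈Vx =
      trans (comm _ _) (h-rev (arcFrom (o x)))

    starVal-bridge-◅◅ : ∀ {a x c b} (adj₁ : Adjacent B (old a) (new x)) (adj₂ : Adjacent B (new x) (old c))
                        (w : Walk A c b) →
                        h (B (old a) (new x)) ∙ (h (B (new x) (old c)) ∙ starVal w) ≈ starVal (bridge adj₁ adj₂ ◅◅ w)
    starVal-bridge-◅◅ {a} {x} {c} adj₁ adj₂ w = begin
      h (B (old a) (new x)) ∙ (h (B (new x) (old c)) ∙ starVal w)  ≈⟨ sym (assoc _ _ _) ⟩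
      (h (B (old a) (new x)) ∙ h (B (new x) (old c))) ∙ starVal w  ≈⟨ ∙-congʳ (arcs-at-new-cancel adj₁ adj₂) ⟩
      ε ∙ starVal w                                                ≈⟨ ∙-congʳ (sym (starVal-bridge adj₁ adj₂)) ⟩
      starVal (bridge adj₁ adj₂) ∙ starVal w                       ≈⟨ sym (starVal-◅◅ (bridge adj₁ adj₂) w) ⟩
      starVal (bridge adj₁ adj₂ ◅◅ w)                              ∎

    project : ∀ a ys b → Linked (Adjacent B) (old a ∷ ys ++ [ old b ]) →
              Σ (Walk A a b) λ w → W B (old a ∷ ys ++ [ old b ]) ≈ starVal w
    project-new : ∀ a x ys b → Linked (Adjacent B) (old a ∷ new x ∷ ys ++ [ old b ]) →
                  Σ (Walk A a b) λ w → W B (old a ∷ new x ∷ ys ++ [ old b ]) ≈ starVal w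

    project a [] b (adj ∷ [-]) =
      old-edge adj ◅ Star.ε , ∙-congʳ (reflexive (cong h (extend-old-old a b)))
    project a (y ∷ ys) b lnk with side y
    project a (_ ∷ ys) b (adj ∷ lnk) | old-vertex u with project u ys b lnk
    ... | w , eq = old-edge adj ◅ w , ∙-cong (reflexive (cong h (extend-old-old a u))) eq
    project a (_ ∷ ys) b lnk | new-vertex x = project-new a x ys b lnk

    project-new a x [] b (adj₁ ∷ adj₂ ∷ [-]) =
      bridge adj₁ adj₂ ◅◅ Star.ε , starVal-bridge-◅◅ adj₁ adj₂ Star.ε
    project-new a x (y ∷ ys) b lnk with side y
    project-new a x (_ ∷ ys) b (_ ∷ adj ∷ _) | new-vertex x′ = ⊥-elim (adj (extend-new-new x x′))
    project-new a x (_ ∷ ys) b (adj₁ ∷ adj₂ ∷ lnk) | old-vertex c with project c ys b lnk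
    ... | w , eq = bridge adj₁ adj₂ ◅◅ w , trans (∙-congˡ (∙-congˡ eq)) (starVal-bridge-◅◅ adj₁ adj₂ w)

    closed-walk-old-trivial : ∀ a ys → Linked (Adjacent B) (old a ∷ ys ++ [ old a ]) →
                             W B (old a ∷ ys ++ [ old a ]) ≈ ε
    closed-walk-old-trivial a ys lnk with project a ys a lnk
    ... | w , eq = trans eq (closed-walk-trivial w)

    extend-isMonograph : IsMonograph G α B
    extend-isMonograph v rest _ _ lnk with side v
    ... | old-vertex a = closed-walk-old-trivial a rest lnk
    extend-isMonograph _ (y ∷ rest) _ _ lnk | new-vertex x with side y | lnk
    ... | new-vertex x′ | adj ∷ _ = ⊥-elim (adj (extend-new-new x x′))
    ... | old-vertex c  | _ = trans (walkVal-rotate B rest)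
                                    (closed-walk-old-trivial c (rest ++ [ new x ]) (linked-rotate rest lnk))

theorem4p12 : ∀ {c ℓ} (G : AbelianGroup c ℓ) (α : AbelianGroup.Carrier G) →
    {n : ℕ} (A : AdjMat n) → IsMixedGraph A → IsMonograph G α A →
    (U : DigonConnectedSubgraph A) →
    (m : ℕ) (V : Fin m → Subset n) (o : Fin m → Orientation) →
    (∀ x → V x ⊆ DigonConnectedSubgraph.verts U) →
    IsMonograph G α (extend A V o)
theorem4p12 G α A mixed mono U m V o V⊆U = Extension.extend-isMonograph G α mixed mono U V o V⊆U
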